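{- For every integer $n\ge 5$, $$b(C(n;1,2)) = \left\lceil \frac{1+\sqrt{1+8n}}{4}\right\rceil.$$
   Context: For an integer $n$ and positive integers $s_1<\dots<s_t\le n/2$, the circulant graph $C(n;s_1,\dots,s_t)$ has vertex set $\mathbb Z_n$, with distinct vertices $x,y$ adjacent iff $x-y \equiv \pm s_i \pmod n$ for some $i$. For a finite connected graph $G$, let $N_\ell[x]=\{y: d(x,y)\le \ell\}$. A sequence of vertices $(x_1,\dots,x_k)$ is a burning sequence of $G$ if $N_{k-1}[x_1]\cup N_{k-2}[x_2]\cup\cdots\cup N_0[x_k]=V(G)$; the burning number $b(G)$ is the minimum length of a burning sequence of $G$. -}

module Defs where

open import Data.Nat using (ℕ; zero; suc; _+_; _*_; _∸_; _^_; _≤_; _<_; NonZero)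
open import Data.Nat.DivMod using (_%_)
open import Data.Fin using (Fin; toℕ)
open import Data.List using (List; _∷_; [])
open import Data.List.Relation.Unary.Any using (Any)
open import Data.Vec using (Vec; lookup)
open import Data.Product using (Σ; ∃; _×_)
open import Data.Sum using (_⊎_)
open import Relation.Binary.PropositionalEquality using (_≡_; _≢_)

CircAdj : (n : ℕ) → .{{NonZero n}} → List ℕ → Fin n → Fin n → Set
CircAdj n S x y =
  x ≢ y × Any (λ s → (toℕ x % n ≡ (toℕ y + s) % n) ⊎ (toℕ y % n ≡ (toℕ x + s) % n)) S

-- WithinDist R ℓ x y : there is a walk of length ≤ ℓ from x to y,
-- i.e. d(x,y) ≤ ℓ, i.e. y ∈ N_ℓ[x].
data WithinDist {V : Set} (R : V → V → Set) : ℕ → V → V → Set where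
  here : ∀ {ℓ x} → WithinDist R ℓ x x
  step : ∀ {ℓ x y z} → R x y → WithinDist R ℓ y z → WithinDist R (suc ℓ) x z

-- (x_1,…,x_k) (stored as xs with x_{i+1} = lookup xs i, i : Fin k) is a burning
-- sequence: every vertex lies in N_{k-1-i}[x_{i+1}] for some i.
IsBurningSeq : {V : Set} (R : V → V → Set) {k : ℕ} → Vec V k → Set
IsBurningSeq {V} R {k} xs =
  (v : V) → ∃ λ (i : Fin k) → WithinDist R (k ∸ suc (toℕ i)) (lookup xs i) v

IsBurningNumber : {V : Set} (R : V → V → Set) → ℕ → Set
IsBurningNumber {V} R b =
  (Σ (Vec V b) (IsBurningSeq R)) ×
  ((k : ℕ) (xs : Vec V k) → IsBurningSeq R xs → b ≤ k)

-- k = ⌈(1 + √(1+8n)) / 4⌉, i.e. k - 1 < (1+√(1+8n))/4 ≤ k, written over ℕ: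
--   (1+√(1+8n))/4 ≤ k  ⇔  1 ≤ k and 1+8n ≤ (4k-1)²
--   k-1 < (1+√(1+8n))/4 ⇔  (4k ∸ 5)² < 1+8n   (trivial when 4k < 5)
IsCeilExpr : ℕ → ℕ → Set
IsCeilExpr n k =
  1 ≤ k × (1 + 8 * n ≤ (4 * k ∸ 1) ^ 2) × ((4 * k ∸ 5) ^ 2 < 1 + 8 * n)

-- In C(n; S) with every s ∈ S at most m, one step moves at most m around the cycle, so a ball of
-- radius r lies in an arc of 2mr + 1 consecutive vertices; for S = {1, 2} the steps ±1, ±2 reach
-- all of that arc from its midpoint. Hence k balls of radii 0, …, k - 1 cover at most
-- Σ_{r<k} (4r + 1) = k(2k - 1) vertices, and laying the arcs end to end attains this. So b is the
-- least k with n ≤ k(2k - 1), which is the stated ceiling because 1 + 8k(2k - 1) = (4k - 1)².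
module Submission where

open import Defs
open import Data.Nat using (ℕ; zero; suc; _+_; _*_; _∸_; _^_; _≤_; _<_; z≤n; s≤s; s≤s⁻¹; NonZero; pred; _≤?_; _<?_)
open import Data.Nat.Properties
open import Algebra.Properties.CommutativeSemigroup +-commutativeSemigroup using (x∙yz≈y∙xz; x∙yz≈xz∙y; xy∙z≈xz∙y)
open import Data.Nat.DivMod using (_%_; _mod_; m%n<n; m%n%n≡m%n; %-distribˡ-+; [m+kn]%n≡m%n; m<n⇒m%n≡m)
open import Data.Nat.Tactic.RingSolver using (solve-∀)
open import Data.Fin using (Fin; toℕ) renaming (zero to fzero; suc to fsuc)
import Data.Fin.Properties as Fin
open import Data.List as List using (List; []; _∷_; _++_; length; applyUpTo)
open import Data.List.Properties using (length-++; length-applyUpTo)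
open import Data.List.Relation.Unary.Any as Any using (index)
open import Data.List.Relation.Unary.Any.Properties using (lookup-index)
open import Data.List.Relation.Unary.All as All using (All)
open import Data.List.Membership.Propositional using (_∈_; lose)
open import Data.List.Membership.Propositional.Properties using (∈-++⁺ˡ; ∈-++⁺ʳ; ∈-applyUpTo⁺)
open import Data.Vec using (Vec; lookup) renaming ([] to []ᵥ; _∷_ to _∷ᵥ_)
open import Data.Product using (∃; _×_; _,_)
open import Data.Sum using (inj₁; inj₂)
open import Relation.Nullary using (yes; no; contradiction)
open import Relation.Binary.PropositionalEquality

sumBelow : ℕ → (ℕ → ℕ) → ℕ
sumBelow zero    g = 0
sumBelow (suc k) g = g k + sumBelow k g

sumBelow-mono-≤ : ∀ g {j k} → j ≤ k → sumBelow j g ≤ sumBelow k g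
sumBelow-mono-≤ g {k = zero}  z≤n  = z≤n
sumBelow-mono-≤ g {k = suc k} j≤1+k with m≤n⇒m<n∨m≡n j≤1+k
... | inj₁ (s≤s j≤k) = ≤-trans (sumBelow-mono-≤ g j≤k) (m≤n+m _ (g k))
... | inj₂ refl      = ≤-refl

WithinDist-suc : ∀ {V} {R : V → V → Set} {ℓ x y} → WithinDist R ℓ x y → WithinDist R (suc ℓ) x y
WithinDist-suc here         = here
WithinDist-suc (step xRy w) = step xRy (WithinDist-suc w)

enumeration⇒n≤length : ∀ {n} (xs : List (Fin n)) → (∀ x → x ∈ xs) → n ≤ length xs
enumeration⇒n≤length {n} xs _∈xs with n ≤? length xs
... | yes n≤ = n≤
... | no  n≰ with i , j , i<j , same ← Fin.pigeonhole (≰⇒> n≰) (λ x → index (x ∈xs)) =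
  contradiction (trans (lookup-index (i ∈xs))
                  (trans (cong (List.lookup xs) same) (sym (lookup-index (j ∈xs)))))
                (Fin.<⇒≢ i<j)

burningSeq⇒n≤sumBelow : ∀ {n} {R : Fin n → Fin n → Set}
  (size : ℕ → ℕ) (ball : ℕ → Fin n → List (Fin n)) →
  (∀ r c → length (ball r c) ≤ size r) → (∀ {r c y} → WithinDist R r c y → y ∈ ball r c) →
  ∀ {k} (xs : Vec (Fin n) k) → IsBurningSeq R xs → n ≤ sumBelow k size
burningSeq⇒n≤sumBelow {n} {R} size ball length-ball ∈-ball xs burns =
  ≤-trans (enumeration⇒n≤length (burnt xs) burnt-covers) (length-burnt xs)
  where
  burnt : ∀ {k} → Vec (Fin n) k → List (Fin n)
  burnt []ᵥ             = []
  burnt {suc k} (c ∷ᵥ cs) = ball k c ++ burnt cs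

  length-burnt : ∀ {k} (cs : Vec (Fin n) k) → length (burnt cs) ≤ sumBelow k size
  length-burnt []ᵥ              = z≤n
  length-burnt {suc k} (c ∷ᵥ cs) =
    subst (_≤ sumBelow (suc k) size) (sym (length-++ (ball k c)))
          (+-mono-≤ (length-ball k c) (length-burnt cs))

  ∈-burnt : ∀ {k} (cs : Vec (Fin n) k) i {y} →
            WithinDist R (k ∸ suc (toℕ i)) (lookup cs i) y → y ∈ burnt cs
  ∈-burnt (c ∷ᵥ cs) fzero     w = ∈-++⁺ˡ (∈-ball w)
  ∈-burnt {suc k} (c ∷ᵥ cs) (fsuc i) w = ∈-++⁺ʳ (ball k c) (∈-burnt cs i w)

  burnt-covers : ∀ y → y ∈ burnt xs
  burnt-covers y with i , w ← burns y = ∈-burnt xs i w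

infix 4 _≡_[mod_]
_≡_[mod_] : ℕ → ℕ → (n : ℕ) → .{{NonZero n}} → Set
a ≡ b [mod n ] = a % n ≡ b % n

module _ {n : ℕ} .{{_ : NonZero n}} where

  +-congʳ-mod : ∀ {a b} t → a ≡ b [mod n ] → a + t ≡ b + t [mod n ]
  +-congʳ-mod {a} {b} t a≡b = begin
    (a + t) % n           ≡⟨ %-distribˡ-+ a t n ⟩
    (a % n + t % n) % n   ≡⟨ cong (λ u → (u + t % n) % n) a≡b ⟩
    (b % n + t % n) % n   ≡⟨ %-distribˡ-+ b t n ⟨
    (b + t) % n           ∎
    where open ≡-Reasoning

  toℕ-mod : ∀ a → toℕ (a mod n) ≡ a [mod n ]
  toℕ-mod a = trans (cong (_% n) (Fin.toℕ-fromℕ< (m%n<n a n))) (m%n%n≡m%n a n)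

  mod-cong : ∀ {a b} → a ≡ b [mod n ] → a mod n ≡ b mod n
  mod-cong {a} {b} a≡b = Fin.fromℕ<-cong _ _ a≡b (m%n<n a n) (m%n<n b n)

  mod-toℕ : (x : Fin n) → toℕ x mod n ≡ x
  mod-toℕ x = Fin.toℕ-injective (trans (Fin.toℕ-fromℕ< (m%n<n (toℕ x) n)) (m<n⇒m%n≡m (Fin.toℕ<n x)))

  toℕ-mod-+ : ∀ a s → toℕ ((a + s) mod n) ≡ toℕ (a mod n) + s [mod n ]
  toℕ-mod-+ a s = trans (toℕ-mod (a + s)) (sym (+-congʳ-mod s (toℕ-mod a)))

module _ {n : ℕ} .{{_ : NonZero n}} {m : ℕ} where

  offset-step-c≡z+s : ∀ C Z Y j t {s} → s ≤ m → C ≡ Z + s [mod n ] → Y + t ≡ Z + j [mod n ] →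
                 Y + (m + t) ≡ C + (j + m ∸ s) [mod n ]
  offset-step-c≡z+s C Z Y j t {s} s≤m c≡z+s offset = begin
    (Y + (m + t)) % n           ≡⟨ cong (_% n) (x∙yz≈xz∙y Y m t) ⟩
    (Y + t + m) % n             ≡⟨ +-congʳ-mod m offset ⟩
    (Z + j + m) % n             ≡⟨ cong (_% n) regroup ⟩
    (Z + s + (j + m ∸ s)) % n   ≡⟨ +-congʳ-mod (j + m ∸ s) c≡z+s ⟨
    (C + (j + m ∸ s)) % n       ∎
    where
    open ≡-Reasoning
    s≤j+m : s ≤ j + m
    s≤j+m = ≤-trans s≤m (m≤n+m m j)
    regroup : Z + j + m ≡ Z + s + (j + m ∸ s)
    regroup = begin
      Z + j + m               ≡⟨ +-assoc Z j m ⟩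
      Z + (j + m)             ≡⟨ cong (Z +_) (m+[n∸m]≡n s≤j+m) ⟨
      Z + (s + (j + m ∸ s))   ≡⟨ +-assoc Z s _ ⟨
      Z + s + (j + m ∸ s)     ∎

  offset-step-z≡c+s : ∀ C Z Y j t {s} → Z ≡ C + s [mod n ] → Y + t ≡ Z + j [mod n ] →
                 Y + (m + t) ≡ C + (s + (j + m)) [mod n ]
  offset-step-z≡c+s C Z Y j t {s} z≡c+s offset = begin
    (Y + (m + t)) % n       ≡⟨ cong (_% n) (x∙yz≈xz∙y Y m t) ⟩
    (Y + t + m) % n         ≡⟨ +-congʳ-mod m offset ⟩
    (Z + j + m) % n         ≡⟨ cong (_% n) (+-assoc Z j m) ⟩
    (Z + (j + m)) % n       ≡⟨ +-congʳ-mod (j + m) z≡c+s ⟩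
    (C + s + (j + m)) % n   ≡⟨ cong (_% n) (+-assoc C s (j + m)) ⟩
    (C + (s + (j + m))) % n ∎
    where open ≡-Reasoning

  -- t * (n - 1) ≡ - t modulo n.
  undo-offset : ∀ Y C j t → Y + t ≡ C + j [mod n ] → C + t * pred n + j ≡ Y [mod n ]
  undo-offset Y C j t offset = begin
    (C + t * pred n + j) % n   ≡⟨ cong (_% n) (xy∙z≈xz∙y C j (t * pred n)) ⟨
    (C + j + t * pred n) % n   ≡⟨ +-congʳ-mod (t * pred n) offset ⟨
    (Y + t + t * pred n) % n   ≡⟨ cong (_% n) (trans (+-assoc Y t _) (cong (Y +_) t+t*pred≡t*n)) ⟩
    (Y + t * n) % n            ≡⟨ [m+kn]%n≡m%n Y t n ⟩
    Y % n                      ∎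
    where
    open ≡-Reasoning
    t+t*pred≡t*n : t + t * pred n ≡ t * n
    t+t*pred≡t*n = trans (sym (*-suc t (pred n))) (cong (t *_) (suc-pred n))

  offset-bound : ∀ r {j} → j ≤ r * (m + m) → j + (m + m) ≤ suc r * (m + m)
  offset-bound r {j} j≤ = subst (j + (m + m) ≤_) (+-comm (r * (m + m)) (m + m)) (+-monoˡ-≤ (m + m) j≤)

  arcFrom : ℕ → ℕ → Fin n
  arcFrom a j = (a + j) mod n

  arc : ℕ → Fin n → List (Fin n)
  arc r c = applyUpTo (arcFrom (toℕ c + r * m * pred n)) (suc (r * (m + m)))

  module _ {S : List ℕ} (S≤m : All (_≤ m) S) where

    -- y sits at the signed position j - r m relative to c, recorded without subtraction.
    ball-offset : ∀ {r c y} → WithinDist (CircAdj n S) r c y →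
                  ∃ λ j → j ≤ r * (m + m) × toℕ y + r * m ≡ toℕ c + j [mod n ]
    ball-offset {r} here = r * m , *-monoʳ-≤ r (m≤m+n m m) , refl
    ball-offset {suc r} {c} {y} (step {y = z} (_ , adj) w) with ball-offset w | All.lookupAny S≤m adj
    ... | j , j≤ , offset | s≤m , inj₁ c≡z+s =
      j + m ∸ s ,
      ≤-trans (m∸n≤m (j + m) s) (≤-trans (+-monoʳ-≤ j (m≤m+n m m)) (offset-bound r j≤)) ,
      offset-step-c≡z+s (toℕ c) (toℕ z) (toℕ y) j (r * m) s≤m c≡z+s offset
      where s = Any.lookup adj
    ... | j , j≤ , offset | s≤m , inj₂ z≡c+s =
      s + (j + m) ,
      ≤-trans (+-monoˡ-≤ (j + m) s≤m) (≤-trans (≤-reflexive (x∙yz≈y∙xz m j m)) (offset-bound r j≤)) ,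
      offset-step-z≡c+s (toℕ c) (toℕ z) (toℕ y) j (r * m) z≡c+s offset
      where s = Any.lookup adj

    ∈-arc : ∀ {r c y} → WithinDist (CircAdj n S) r c y → y ∈ arc r c
    ∈-arc {r} {c} {y} w with j , j≤ , offset ← ball-offset w =
      subst (_∈ arc r c) (trans (mod-cong (undo-offset (toℕ y) (toℕ c) j (r * m) offset)) (mod-toℕ y))
            (∈-applyUpTo⁺ (arcFrom _) (s≤s j≤))

    circulant-burningSeq⇒n≤sumBelow : ∀ {k} (xs : Vec (Fin n) k) → IsBurningSeq (CircAdj n S) xs →
                                      n ≤ sumBelow k (λ r → suc (r * (m + m)))
    circulant-burningSeq⇒n≤sumBelow =
      burningSeq⇒n≤sumBelow _ arc (λ r c → ≤-reflexive (length-applyUpTo (arcFrom _) _)) ∈-arc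

capacity : ℕ → ℕ
capacity k = sumBelow k (λ r → suc (r * 4))

module _ {n : ℕ} .{{_ : NonZero n}} {S : List ℕ} (1∈S : 1 ∈ S) (2∈S : 2 ∈ S) where

  private
    Reach : ℕ → Fin n → Fin n → Set
    Reach = WithinDist (CircAdj n S)

    2+d≤2+2r⇒d≤2r : ∀ {d r} → 2 + d ≤ suc r + suc r → d ≤ r + r
    2+d≤2+2r⇒d≤2r {d} {r} le = s≤s⁻¹ (subst (suc d ≤_) (+-suc r r) (s≤s⁻¹ le))

  step-up : ∀ {s ℓ a z} → s ∈ S → Reach ℓ ((a + s) mod n) z →
            Reach (suc ℓ) (a mod n) z
  step-up {s} {ℓ} {a} {z} s∈S w with a mod n Fin.≟ (a + s) mod n
  ... | yes same   = WithinDist-suc (subst (λ x → Reach ℓ x z) (sym same) w)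
  ... | no  differ = step (differ , lose s∈S (inj₂ (toℕ-mod-+ a s))) w

  step-down : ∀ {s ℓ a z} → s ∈ S → Reach ℓ (a mod n) z →
              Reach (suc ℓ) ((a + s) mod n) z
  step-down {s} {ℓ} {a} {z} s∈S w with (a + s) mod n Fin.≟ a mod n
  ... | yes same   = WithinDist-suc (subst (λ x → Reach ℓ x z) (sym same) w)
  ... | no  differ = step (differ , lose s∈S (inj₁ (toℕ-mod-+ a s))) w

  walk-up : ∀ a r d → d ≤ r + r → Reach r (a mod n) ((a + d) mod n)
  walk-up a r       zero          _  = subst (λ u → Reach r (a mod n) (u mod n)) (sym (+-identityʳ a)) here
  walk-up a (suc r) (suc zero)    _  = step-up 1∈S here
  walk-up a (suc r) (suc (suc d)) le =
    step-up 2∈S (subst (λ u → Reach r ((a + 2) mod n) (u mod n)) (+-assoc a 2 d)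
                       (walk-up (a + 2) r d (2+d≤2+2r⇒d≤2r le)))

  walk-down : ∀ a r d → d ≤ r + r → Reach r ((a + d) mod n) (a mod n)
  walk-down a r       zero          _  = subst (λ u → Reach r (u mod n) (a mod n)) (sym (+-identityʳ a)) here
  walk-down a (suc r) (suc zero)    _  = step-down 1∈S here
  walk-down a (suc r) (suc (suc d)) le =
    subst (λ u → Reach (suc r) (u mod n) (a mod n)) (trans (+-assoc a d 2) (cong (a +_) (+-comm d 2)))
          (step-down 2∈S (walk-down a r d (2+d≤2+2r⇒d≤2r le)))

  centre-reaches : ∀ b r e → e ≤ r * 4 → Reach r ((b + (r + r)) mod n) ((b + e) mod n)
  centre-reaches b r e e≤4r with e ≤? r + r
  ... | yes e≤2r = subst (λ u → Reach r (u mod n) ((b + e) mod n))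
                         (trans (+-assoc b e _) (cong (b +_) (m+[n∸m]≡n e≤2r)))
                         (walk-down (b + e) r (r + r ∸ e) (m∸n≤m (r + r) e))
  ... | no  e≰2r = subst (λ u → Reach r ((b + (r + r)) mod n) (u mod n))
                         (trans (+-assoc b _ _) (cong (b +_) (m+[n∸m]≡n 2r≤e)))
                         (walk-up (b + (r + r)) r (e ∸ (r + r)) e∸2r≤2r)
    where
    2r≤e : r + r ≤ e
    2r≤e = <⇒≤ (≰⇒> e≰2r)
    quadruple : ∀ x → x * 4 ≡ x + x + (x + x)
    quadruple = solve-∀
    e∸2r≤2r : e ∸ (r + r) ≤ r + r
    e∸2r≤2r = subst (e ∸ (r + r) ≤_) (m+n∸m≡n (r + r) (r + r))
                    (∸-monoˡ-≤ (r + r) (subst (e ≤_) (quadruple r) e≤4r))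

  centres : (k : ℕ) → Vec (Fin n) k
  centres zero    = []ᵥ
  centres (suc k) = (capacity k + (k + k)) mod n ∷ᵥ centres k

  centres-reach : ∀ k v → v < capacity k →
                  ∃ λ i → Reach (k ∸ suc (toℕ i)) (lookup (centres k) i) (v mod n)
  centres-reach (suc k) v v<cap with v <? capacity k
  ... | yes v<capk = let i , w = centres-reach k v v<capk in fsuc i , w
  ... | no  v≮capk = fzero , subst (λ u → Reach k _ (u mod n)) (m+[n∸m]≡n capk≤v)
                                   (centre-reaches (capacity k) k (v ∸ capacity k) v∸capk≤4k)
    where
    capk≤v : capacity k ≤ v
    capk≤v = ≮⇒≥ v≮capk
    v∸capk≤4k : v ∸ capacity k ≤ k * 4
    v∸capk≤4k = s≤s⁻¹ (subst (v ∸ capacity k <_) (m+n∸n≡m (suc (k * 4)) (capacity k))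
                             (∸-monoˡ-< v<cap capk≤v))

  centres-burn : ∀ k → n ≤ capacity k → IsBurningSeq (CircAdj n S) (centres k)
  centres-burn k n≤cap x with i , w ← centres-reach k (toℕ x) (<-≤-trans (Fin.toℕ<n x) n≤cap) =
    i , subst (Reach (k ∸ suc (toℕ i)) (lookup (centres k) i)) (mod-toℕ x) w

k≤capacity : ∀ k → k ≤ capacity k
k≤capacity zero    = z≤n
k≤capacity (suc k) = s≤s (≤-trans (k≤capacity k) (m≤n+m (capacity k) (k * 4)))

sumBelow-cancel-< : ∀ g {j k} → sumBelow j g < sumBelow k g → j < k
sumBelow-cancel-< g lt = ≰⇒> (λ k≤j → <⇒≱ lt (sumBelow-mono-≤ g k≤j))

straddle : ∀ (f : ℕ → ℕ) {m} b → f 0 < m → m ≤ f b → ∃ λ k → f k < m × m ≤ f (suc k)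
straddle f zero    f0<m m≤f0 = contradiction m≤f0 (<⇒≱ f0<m)
straddle f (suc b) f0<m m≤fb with _ ≤? f b
... | yes m≤fb′ = straddle f b f0<m m≤fb′
... | no  m≰fb′ = b , ≰⇒> m≰fb′ , m≤fb

capacity-square : ∀ k → 1 + 8 * capacity (suc k) ≡ (4 * k + 3) ^ 2
capacity-square zero    = refl
capacity-square (suc k) = begin
  1 + 8 * capacity (suc (suc k))                   ≡⟨ split k (capacity (suc k)) ⟩
  1 + 8 * capacity (suc k) + 8 * suc (suc k * 4)   ≡⟨ cong (_+ 8 * suc (suc k * 4)) (capacity-square k) ⟩
  (4 * k + 3) ^ 2 + 8 * suc (suc k * 4)            ≡⟨ expand k ⟩
  (4 * suc k + 3) ^ 2                              ∎
  where
  open ≡-Reasoning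
  split : ∀ x y → 1 + 8 * (1 + (1 + x) * 4 + y) ≡ 1 + 8 * y + 8 * (1 + (1 + x) * 4)
  split = solve-∀
  -- Spelled as x ^ 2 unfolds, x * (x * 1), since the solver does not accept _^_.
  expand : ∀ x → (4 * x + 3) * ((4 * x + 3) * 1) + 8 * (1 + (1 + x) * 4) ≡
                 (4 * (1 + x) + 3) * ((4 * (1 + x) + 3) * 1)
  expand = solve-∀

capacity-ceiling : ∀ {n} k → capacity k < n → n ≤ capacity (suc k) → IsCeilExpr n (suc k)
capacity-ceiling {n} k cap<n n≤cap = s≤s z≤n , upper , lower k cap<n
  where
  4[1+x]≡1+[4x+3] : ∀ x → 4 * (1 + x) ≡ 1 + (4 * x + 3)
  4[1+x]≡1+[4x+3] = solve-∀
  4[2+x]≡5+[4x+3] : ∀ x → 4 * (2 + x) ≡ 5 + (4 * x + 3)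
  4[2+x]≡5+[4x+3] = solve-∀

  upper : 1 + 8 * n ≤ (4 * suc k ∸ 1) ^ 2
  upper = subst (λ u → 1 + 8 * n ≤ (u ∸ 1) ^ 2) (sym (4[1+x]≡1+[4x+3] k))
                (subst (1 + 8 * n ≤_) (capacity-square k) (+-monoʳ-≤ 1 (*-monoʳ-≤ 8 n≤cap)))

  lower : ∀ k → capacity k < n → (4 * suc k ∸ 5) ^ 2 < 1 + 8 * n
  lower zero    _     = s≤s z≤n
  lower (suc k) cap<n = subst (λ u → (u ∸ 5) ^ 2 < 1 + 8 * n) (sym (4[2+x]≡5+[4x+3] k))
                              (subst (_< 1 + 8 * n) (capacity-square k) (+-monoʳ-< 1 (*-monoʳ-< 8 cap<n)))

mainTheorem11 : (n : ℕ) → .{{_ : NonZero n}} → 5 ≤ n →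
    ∃ λ (k : ℕ) → IsCeilExpr n k × IsBurningNumber (CircAdj n (1 ∷ 2 ∷ [])) k
mainTheorem11 n 5≤n
  with k , cap<n , n≤cap ← straddle capacity n (≤-trans (s≤s z≤n) 5≤n) (k≤capacity n) =
  suc k , capacity-ceiling k cap<n n≤cap ,
  (centres 1∈S 2∈S (suc k) , centres-burn 1∈S 2∈S (suc k) n≤cap) , minimal
  where
  1∈S : 1 ∈ 1 ∷ 2 ∷ []
  1∈S = Any.here refl
  2∈S : 2 ∈ 1 ∷ 2 ∷ []
  2∈S = Any.there (Any.here refl)
  S≤2 : All (_≤ 2) (1 ∷ 2 ∷ [])
  S≤2 = s≤s z≤n All.∷ ≤-refl All.∷ All.[]

  minimal : (k′ : ℕ) (xs : Vec (Fin n) k′) → IsBurningSeq (CircAdj n (1 ∷ 2 ∷ [])) xs → suc k ≤ k′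
  minimal k′ xs burns =
    sumBelow-cancel-< _ (<-≤-trans cap<n (circulant-burningSeq⇒n≤sumBelow S≤2 xs burns))
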